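{- For each $i\in\{0,1,2,4,16\}$ there exist three 4-GDDs of type $4^4$ (on the same point set with the same groups) with exactly $i$ common blocks.
   Context: A 4-GDD of type $4^4$ is a triple $(\mathcal{X},\mathcal{G},\mathcal{A})$ where $\mathcal{G}$ is a partition of a 16-element set $\mathcal{X}$ into four groups of size 4, $\mathcal{A}$ is a set of 4-subsets of $\mathcal{X}$ (blocks), each block meets each group in at most one element, and every pair of elements from distinct groups lies in exactly one block. Three such GDDs $(\mathcal{X},\mathcal{G},\mathcal{A}_j)$, $j=1,2,3$, have exactly $i$ common blocks if $\mathcal{A}_1\cap\mathcal{A}_2=\mathcal{A}_1\cap\mathcal{A}_3=\mathcal{A}_2\cap\mathcal{A}_3$ and this set has exactly $i$ blocks. -}

module Defs where

open import Data.Nat using (ℕ; _≤_)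
open import Data.Fin using (Fin)
open import Data.Fin.Subset using (Subset; _∈_; _∩_; ∣_∣)
open import Data.List using (List; length)
open import Data.List.Relation.Unary.Unique.Propositional using (Unique)
import Data.List.Membership.Propositional as L
open import Data.Product using (_×_; Σ; ∃-syntax)
open import Relation.Binary.PropositionalEquality using (_≡_; _≢_)
open import Function.Bundles using (_⇔_)

-- The point set X is taken to be Fin 16 (any 16-element set is in bijection with it).
Point : Set
Point = Fin 16

Block : Set
Block = Subset 16

record IsGroupPartition (G : Fin 4 → Subset 16) : Set where
  field
    group-size : ∀ j → ∣ G j ∣ ≡ 4
    covers     : ∀ (x : Point) → ∃[ j ] (x ∈ G j)
    disjoint   : ∀ (x : Point) (j k : Fin 4) → x ∈ G j → x ∈ G k → j ≡ k

record IsGDD (G : Fin 4 → Subset 16) (A : List Block) : Set where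
  field
    blocks-distinct : Unique A
    block-size      : ∀ B → B L.∈ A → ∣ B ∣ ≡ 4
    block-transversal : ∀ B → B L.∈ A → ∀ j → ∣ B ∩ G j ∣ ≤ 1
    pair-covered    : ∀ (x y : Point) (j k : Fin 4) → j ≢ k → x ∈ G j → y ∈ G k →
                      ∃[ B ] (B L.∈ A × x ∈ B × y ∈ B)
    pair-unique     : ∀ (x y : Point) (j k : Fin 4) → j ≢ k → x ∈ G j → y ∈ G k →
                      ∀ B B′ → B L.∈ A → x ∈ B → y ∈ B →
                      B′ L.∈ A → x ∈ B′ → y ∈ B′ → B ≡ B′

record ExactlyCommon (i : ℕ) (A₁ A₂ A₃ : List Block) : Set where
  field
    eq₁₂-₁₃ : ∀ B → (B L.∈ A₁ × B L.∈ A₂) ⇔ (B L.∈ A₁ × B L.∈ A₃)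
    eq₁₂-₂₃ : ∀ B → (B L.∈ A₁ × B L.∈ A₂) ⇔ (B L.∈ A₂ × B L.∈ A₃)
    common  : List Block
    common-distinct : Unique common
    common-spec : ∀ B → B L.∈ common ⇔ (B L.∈ A₁ × B L.∈ A₂)
    common-size : length common ≡ i

-- A 4-GDD of type 4^4 is a transversal design TD(4,4), i.e. a pair of orthogonal Latin
-- squares L, M of order 4: cell (r, c) gives the block consisting of the r-th point of the
-- first group, the c-th of the second, the L(r, c)-th of the third and the M(r, c)-th of the
-- fourth.  For each i we exhibit three such pairs whose designs pairwise share exactly the
-- same i blocks; the GDD axioms and the intersection pattern are finite properties of
-- explicit data, decided by evaluation.
module Submission where

open import Defs
open import Data.Nat using (ℕ)
open import Data.Fin using (Fin)
open import Data.Fin.Subset using (Subset)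
open import Data.List using (List; _∷_; [])
open import Data.List.Membership.Propositional using (_∈_)
open import Data.Product using (_×_; ∃-syntax)

open import Data.Bool.Properties as Bool using ()
open import Data.Fin as Fin using (#_; combine)
open import Data.Fin.Properties using (all?; any?)
open import Data.Fin.Subset as Subset using (⁅_⁆; ⋃; ∣_∣; _∩_)
open import Data.Fin.Subset.Properties using (_∈?_)
open import Data.List using (length; filter; map; allFin; zip; zipWith; cartesianProduct)
open import Data.List.Membership.DecPropositional as DecMembership using ()
open import Data.List.Membership.Propositional using (find)
open import Data.List.Membership.Propositional.Properties using (∈-filter⁺; ∈-filter⁻)
open import Data.List.Relation.Unary.All as All using (All)
open import Data.List.Relation.Unary.AllPairs as AllPairs using (AllPairs)
open import Data.List.Relation.Unary.Any as Any using (Any; here; there)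
open import Data.List.Relation.Unary.Unique.Propositional using (Unique)
open import Data.List.Relation.Unary.Unique.Propositional.Properties using (filter⁺)
open import Data.Nat as ℕ using (_≤_)
open import Data.Product using (_,_)
open import Data.Sum using (_⊎_; inj₁; inj₂)
open import Data.Vec.Properties using (≡-dec)
open import Function using (_∘_; case_of_)
open import Function.Bundles using (mk⇔)
open import Relation.Binary.Definitions using (DecidableEquality)
open import Relation.Binary.PropositionalEquality using (_≡_; refl; _≢_; sym; trans)
open import Relation.Nullary using (Dec; ¬?; contradiction)
open import Relation.Nullary.Decidable using (True; toWitness; from-yes; _×-dec_; _⊎-dec_; _→-dec_)
open import Relation.Unary using (Decidable)

_≟ᴮ_ : DecidableEquality Block
_≟ᴮ_ = ≡-dec Bool._≟_

open DecMembership _≟ᴮ_ using () renaming (_∈?_ to _∈ᴮ?_)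

module _ {G : Fin 4 → Subset 16} (partition : IsGroupPartition G) where

  open IsGroupPartition partition

  distinctGroups⇒distinctPoints : ∀ {x y j k} → j ≢ k → x Subset.∈ G j → y Subset.∈ G k → x ≢ y
  distinctGroups⇒distinctPoints j≢k x∈Gj y∈Gk refl = j≢k (disjoint _ _ _ x∈Gj y∈Gk)

  -- A decidable strengthening of IsGDD: every quantifier over blocks ranges over the list A.
  GDDConditions : List Block → Set
  GDDConditions A =
    AllPairs _≢_ A
    × All (λ B → ∣ B ∣ ≡ 4) A
    × All (λ B → ∀ j → ∣ B ∩ G j ∣ ≤ 1) A
    × (∀ x y → Any (λ B → x Subset.∈ B × y Subset.∈ B) A ⊎ ∃[ j ] (x Subset.∈ G j × y Subset.∈ G j))
    × All (λ B → ∀ x → x Subset.∈ B → ∀ y → y Subset.∈ B → x ≢ y →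
                 All (λ B′ → x Subset.∈ B′ → y Subset.∈ B′ → B ≡ B′) A) A

  gddConditions? : Decidable GDDConditions
  gddConditions? A =
    AllPairs.allPairs? (λ B B′ → ¬? (B ≟ᴮ B′)) A
    ×-dec All.all? (λ B → ∣ B ∣ ℕ.≟ 4) A
    ×-dec All.all? (λ B → all? λ j → ∣ B ∩ G j ∣ ℕ.≤? 1) A
    ×-dec (all? λ x → all? λ y →
             Any.any? (λ B → x ∈? B ×-dec y ∈? B) A ⊎-dec any? λ j → x ∈? G j ×-dec y ∈? G j)
    ×-dec All.all? (λ B → all? λ x → x ∈? B →-dec all? λ y → y ∈? B →-dec ¬? (x Fin.≟ y) →-dec
             All.all? (λ B′ → x ∈? B′ →-dec y ∈? B′ →-dec B ≟ᴮ B′) A) A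

  gddConditions⇒IsGDD : ∀ {A} → GDDConditions A → IsGDD G A
  gddConditions⇒IsGDD (distinct , size , transversal , covered , unique) = record
    { blocks-distinct   = distinct
    ; block-size        = λ _ → All.lookup size
    ; block-transversal = λ _ → All.lookup transversal
    ; pair-covered      = λ x y j k j≢k x∈Gj y∈Gk → case covered x y of λ where
        (inj₁ common) → let (B , B∈A , x∈B , y∈B) = find common in B , B∈A , x∈B , y∈B
        (inj₂ (l , x∈Gl , y∈Gl)) →
          contradiction (trans (disjoint _ _ _ x∈Gj x∈Gl) (sym (disjoint _ _ _ y∈Gk y∈Gl))) j≢k
    ; pair-unique       = λ x y j k j≢k x∈Gj y∈Gk B B′ B∈A x∈B y∈B B′∈A x∈B′ y∈B′ →
        All.lookup (All.lookup unique B∈A x x∈B y y∈B (distinctGroups⇒distinctPoints j≢k x∈Gj y∈Gk))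
          B′∈A x∈B′ y∈B′
    }

commonBlocks : List Block → List Block → List Block
commonBlocks A₁ A₂ = filter (_∈ᴮ? A₂) A₁

-- The three pairwise intersections coincide iff each of them lies in the remaining list.
PairwiseCommonInThird : List Block → List Block → List Block → Set
PairwiseCommonInThird A₁ A₂ A₃ =
  All (λ B → B ∈ A₂ → B ∈ A₃) A₁ × All (λ B → B ∈ A₃ → B ∈ A₂) A₁ × All (λ B → B ∈ A₃ → B ∈ A₁) A₂

pairwiseCommonInThird? : ∀ A₁ A₂ A₃ → Dec (PairwiseCommonInThird A₁ A₂ A₃)
pairwiseCommonInThird? A₁ A₂ A₃ =
  All.all? (λ B → B ∈ᴮ? A₂ →-dec B ∈ᴮ? A₃) A₁
  ×-dec All.all? (λ B → B ∈ᴮ? A₃ →-dec B ∈ᴮ? A₂) A₁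
  ×-dec All.all? (λ B → B ∈ᴮ? A₃ →-dec B ∈ᴮ? A₁) A₂

exactlyCommonBlocks : ∀ {A₁ A₂ A₃} → Unique A₁ → PairwiseCommonInThird A₁ A₂ A₃ →
                      ExactlyCommon (length (commonBlocks A₁ A₂)) A₁ A₂ A₃
exactlyCommonBlocks {A₁} {A₂} unique (₁₂⊆₃ , ₁₃⊆₂ , ₂₃⊆₁) = record
  { eq₁₂-₁₃         = λ _ → mk⇔ (λ (p , q) → p , All.lookup ₁₂⊆₃ p q)
                                (λ (p , r) → p , All.lookup ₁₃⊆₂ p r)
  ; eq₁₂-₂₃         = λ _ → mk⇔ (λ (p , q) → q , All.lookup ₁₂⊆₃ p q)
                                (λ (q , r) → All.lookup ₂₃⊆₁ q r , q)
  ; common          = commonBlocks A₁ A₂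
  ; common-distinct = filter⁺ (_∈ᴮ? A₂) unique
  ; common-spec     = λ _ → mk⇔ (∈-filter⁻ (_∈ᴮ? A₂)) (λ (p , q) → ∈-filter⁺ (_∈ᴮ? A₂) p q)
  ; common-size     = refl
  }

-- Point x of group j is 4 j + x.
point : Fin 4 → Fin 4 → Point
point = combine

pointSet : List Point → Subset 16
pointSet = ⋃ ∘ map ⁅_⁆

groups : Fin 4 → Subset 16
groups j = pointSet (map (point j) (allFin 4))

groupPartition : IsGroupPartition groups
groupPartition = record
  { group-size = from-yes (all? λ j → ∣ groups j ∣ ℕ.≟ 4)
  ; covers     = from-yes (all? λ x → any? λ j → x ∈? groups j)
  ; disjoint   = from-yes (all? λ x → all? λ j → all? λ k →
                             x ∈? groups j →-dec x ∈? groups k →-dec j Fin.≟ k)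
  }

-- Squares are listed row by row.
Square : Set
Square = List (Fin 4)

transversalDesign : Square → Square → List Block
transversalDesign L M = zipWith cellBlock (cartesianProduct (allFin 4) (allFin 4)) (zip L M)
  where
  cellBlock : Fin 4 × Fin 4 → Fin 4 × Fin 4 → Block
  cellBlock (r , c) (l , m) =
    pointSet (point (# 0) r ∷ point (# 1) c ∷ point (# 2) l ∷ point (# 3) m ∷ [])

ThreeGDDsWithCommonBlocks : ℕ → Set
ThreeGDDsWithCommonBlocks i = ∃[ G ] ∃[ A₁ ] ∃[ A₂ ] ∃[ A₃ ]
  (IsGroupPartition G × IsGDD G A₁ × IsGDD G A₂ × IsGDD G A₃ × ExactlyCommon i A₁ A₂ A₃)

threeGDDs : ∀ A₁ A₂ A₃ →
  {_ : True (gddConditions? groupPartition A₁)} →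
  {_ : True (gddConditions? groupPartition A₂)} →
  {_ : True (gddConditions? groupPartition A₃)} →
  {_ : True (pairwiseCommonInThird? A₁ A₂ A₃)} →
  ThreeGDDsWithCommonBlocks (length (commonBlocks A₁ A₂))
threeGDDs A₁ A₂ A₃ {gdd₁} {gdd₂} {gdd₃} {common} =
  groups , A₁ , A₂ , A₃ , groupPartition , isGDD gdd₁ , isGDD gdd₂ , isGDD gdd₃ ,
  exactlyCommonBlocks (IsGDD.blocks-distinct (isGDD gdd₁)) (toWitness common)
  where
  isGDD : ∀ {A} → True (gddConditions? groupPartition A) → IsGDD groups A
  isGDD = gddConditions⇒IsGDD groupPartition ∘ toWitness

baseDesign : List Block
baseDesign = transversalDesign
  (# 3 ∷ # 0 ∷ # 2 ∷ # 1 ∷ # 2 ∷ # 1 ∷ # 3 ∷ # 0 ∷ # 1 ∷ # 2 ∷ # 0 ∷ # 3 ∷ # 0 ∷ # 3 ∷ # 1 ∷ # 2 ∷ [])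
  (# 2 ∷ # 0 ∷ # 3 ∷ # 1 ∷ # 0 ∷ # 2 ∷ # 1 ∷ # 3 ∷ # 3 ∷ # 1 ∷ # 2 ∷ # 0 ∷ # 1 ∷ # 3 ∷ # 0 ∷ # 2 ∷ [])

noCommonBlock : ThreeGDDsWithCommonBlocks 0
noCommonBlock = threeGDDs
  baseDesign
  (transversalDesign
    (# 0 ∷ # 3 ∷ # 1 ∷ # 2 ∷ # 3 ∷ # 0 ∷ # 2 ∷ # 1 ∷ # 1 ∷ # 2 ∷ # 0 ∷ # 3 ∷ # 2 ∷ # 1 ∷ # 3 ∷ # 0 ∷ [])
    (# 0 ∷ # 1 ∷ # 2 ∷ # 3 ∷ # 3 ∷ # 2 ∷ # 1 ∷ # 0 ∷ # 1 ∷ # 0 ∷ # 3 ∷ # 2 ∷ # 2 ∷ # 3 ∷ # 0 ∷ # 1 ∷ []))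
  (transversalDesign
    (# 3 ∷ # 2 ∷ # 0 ∷ # 1 ∷ # 0 ∷ # 1 ∷ # 3 ∷ # 2 ∷ # 2 ∷ # 3 ∷ # 1 ∷ # 0 ∷ # 1 ∷ # 0 ∷ # 2 ∷ # 3 ∷ [])
    (# 0 ∷ # 2 ∷ # 1 ∷ # 3 ∷ # 2 ∷ # 0 ∷ # 3 ∷ # 1 ∷ # 3 ∷ # 1 ∷ # 2 ∷ # 0 ∷ # 1 ∷ # 3 ∷ # 0 ∷ # 2 ∷ []))

oneCommonBlock : ThreeGDDsWithCommonBlocks 1
oneCommonBlock = threeGDDs
  (transversalDesign
    (# 2 ∷ # 1 ∷ # 3 ∷ # 0 ∷ # 1 ∷ # 2 ∷ # 0 ∷ # 3 ∷ # 0 ∷ # 3 ∷ # 1 ∷ # 2 ∷ # 3 ∷ # 0 ∷ # 2 ∷ # 1 ∷ [])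
    (# 1 ∷ # 3 ∷ # 0 ∷ # 2 ∷ # 2 ∷ # 0 ∷ # 3 ∷ # 1 ∷ # 0 ∷ # 2 ∷ # 1 ∷ # 3 ∷ # 3 ∷ # 1 ∷ # 2 ∷ # 0 ∷ []))
  (transversalDesign
    (# 0 ∷ # 2 ∷ # 3 ∷ # 1 ∷ # 3 ∷ # 1 ∷ # 0 ∷ # 2 ∷ # 2 ∷ # 0 ∷ # 1 ∷ # 3 ∷ # 1 ∷ # 3 ∷ # 2 ∷ # 0 ∷ [])
    (# 3 ∷ # 0 ∷ # 1 ∷ # 2 ∷ # 2 ∷ # 1 ∷ # 0 ∷ # 3 ∷ # 1 ∷ # 2 ∷ # 3 ∷ # 0 ∷ # 0 ∷ # 3 ∷ # 2 ∷ # 1 ∷ []))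
  (transversalDesign
    (# 2 ∷ # 3 ∷ # 0 ∷ # 1 ∷ # 3 ∷ # 2 ∷ # 1 ∷ # 0 ∷ # 1 ∷ # 0 ∷ # 3 ∷ # 2 ∷ # 0 ∷ # 1 ∷ # 2 ∷ # 3 ∷ [])
    (# 0 ∷ # 2 ∷ # 1 ∷ # 3 ∷ # 1 ∷ # 3 ∷ # 0 ∷ # 2 ∷ # 2 ∷ # 0 ∷ # 3 ∷ # 1 ∷ # 3 ∷ # 1 ∷ # 2 ∷ # 0 ∷ []))

twoCommonBlocks : ThreeGDDsWithCommonBlocks 2
twoCommonBlocks = threeGDDs
  (transversalDesign
    (# 1 ∷ # 2 ∷ # 0 ∷ # 3 ∷ # 2 ∷ # 1 ∷ # 3 ∷ # 0 ∷ # 3 ∷ # 0 ∷ # 2 ∷ # 1 ∷ # 0 ∷ # 3 ∷ # 1 ∷ # 2 ∷ [])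
    (# 0 ∷ # 1 ∷ # 3 ∷ # 2 ∷ # 3 ∷ # 2 ∷ # 0 ∷ # 1 ∷ # 1 ∷ # 0 ∷ # 2 ∷ # 3 ∷ # 2 ∷ # 3 ∷ # 1 ∷ # 0 ∷ []))
  (transversalDesign
    (# 2 ∷ # 0 ∷ # 1 ∷ # 3 ∷ # 1 ∷ # 3 ∷ # 2 ∷ # 0 ∷ # 3 ∷ # 1 ∷ # 0 ∷ # 2 ∷ # 0 ∷ # 2 ∷ # 3 ∷ # 1 ∷ [])
    (# 1 ∷ # 3 ∷ # 0 ∷ # 2 ∷ # 2 ∷ # 0 ∷ # 3 ∷ # 1 ∷ # 3 ∷ # 1 ∷ # 2 ∷ # 0 ∷ # 0 ∷ # 2 ∷ # 1 ∷ # 3 ∷ []))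
  (transversalDesign
    (# 0 ∷ # 2 ∷ # 1 ∷ # 3 ∷ # 3 ∷ # 1 ∷ # 2 ∷ # 0 ∷ # 2 ∷ # 0 ∷ # 3 ∷ # 1 ∷ # 1 ∷ # 3 ∷ # 0 ∷ # 2 ∷ [])
    (# 3 ∷ # 0 ∷ # 1 ∷ # 2 ∷ # 0 ∷ # 3 ∷ # 2 ∷ # 1 ∷ # 1 ∷ # 2 ∷ # 3 ∷ # 0 ∷ # 2 ∷ # 1 ∷ # 0 ∷ # 3 ∷ []))

fourCommonBlocks : ThreeGDDsWithCommonBlocks 4
fourCommonBlocks = threeGDDs
  (transversalDesign
    (# 3 ∷ # 1 ∷ # 0 ∷ # 2 ∷ # 2 ∷ # 0 ∷ # 1 ∷ # 3 ∷ # 0 ∷ # 2 ∷ # 3 ∷ # 1 ∷ # 1 ∷ # 3 ∷ # 2 ∷ # 0 ∷ [])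
    (# 0 ∷ # 2 ∷ # 3 ∷ # 1 ∷ # 2 ∷ # 0 ∷ # 1 ∷ # 3 ∷ # 1 ∷ # 3 ∷ # 2 ∷ # 0 ∷ # 3 ∷ # 1 ∷ # 0 ∷ # 2 ∷ []))
  (transversalDesign
    (# 3 ∷ # 1 ∷ # 0 ∷ # 2 ∷ # 2 ∷ # 0 ∷ # 1 ∷ # 3 ∷ # 0 ∷ # 2 ∷ # 3 ∷ # 1 ∷ # 1 ∷ # 3 ∷ # 2 ∷ # 0 ∷ [])
    (# 3 ∷ # 1 ∷ # 0 ∷ # 2 ∷ # 0 ∷ # 2 ∷ # 3 ∷ # 1 ∷ # 1 ∷ # 3 ∷ # 2 ∷ # 0 ∷ # 2 ∷ # 0 ∷ # 1 ∷ # 3 ∷ []))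
  (transversalDesign
    (# 1 ∷ # 3 ∷ # 2 ∷ # 0 ∷ # 3 ∷ # 1 ∷ # 0 ∷ # 2 ∷ # 0 ∷ # 2 ∷ # 3 ∷ # 1 ∷ # 2 ∷ # 0 ∷ # 1 ∷ # 3 ∷ [])
    (# 3 ∷ # 1 ∷ # 0 ∷ # 2 ∷ # 0 ∷ # 2 ∷ # 3 ∷ # 1 ∷ # 1 ∷ # 3 ∷ # 2 ∷ # 0 ∷ # 2 ∷ # 0 ∷ # 1 ∷ # 3 ∷ []))

allBlocksCommon : ThreeGDDsWithCommonBlocks 16
allBlocksCommon = threeGDDs baseDesign baseDesign baseDesign

lemma4p5 : ∀ (i : ℕ) → i ∈ (0 ∷ 1 ∷ 2 ∷ 4 ∷ 16 ∷ []) →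
    ∃[ G ] ∃[ A₁ ] ∃[ A₂ ] ∃[ A₃ ]
    (IsGroupPartition G × IsGDD G A₁ × IsGDD G A₂ × IsGDD G A₃ × ExactlyCommon i A₁ A₂ A₃)
lemma4p5 _ (here refl)                                   = noCommonBlock
lemma4p5 _ (there (here refl))                           = oneCommonBlock
lemma4p5 _ (there (there (here refl)))                   = twoCommonBlocks
lemma4p5 _ (there (there (there (here refl))))           = fourCommonBlocks
lemma4p5 _ (there (there (there (there (here refl)))))   = allBlocksCommon
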